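{- Let $(N,\oplus,\ominus)$ be a DFBQ in which $e\in N$ is a right identity for $\oplus$, $a\ominus a=e$ for all $a$, and $a\ominus e=a$ for all $a\in N$. Let $\phi$ be a permutation of $N$ such that $a\ominus b=\phi a\ominus\phi b$ for all $a,b$, and $\alpha$ a permutation of $N$ with $\alpha e=e$. Define $a+b=\phi(\phi^{ -1}a\oplus\phi^{ -1}b)$ and $a-b=\alpha(\phi^{ -1}a\ominus\phi^{ -1}b)$, and let $o:=\phi e$. Then $(N,+,-)$ is a DFBQ with right additive identity $o$ and with $a-a=e$ for all $a$; moreover $\alpha(a)=a-e$ for all $a$, and $\phi(a)=a+\bar e$ for all $a$, where $\bar e$ is such that $e+\bar e=o$.
   Context: A DFBQ $(N,+,-)$ is a set $N$ with two binary operations $+$ and $-$ such that $(N,+)$ and $(N,-)$ are both quasigroups (for all $a,b$, the equations $a\circ x=b$ and $y\circ a=b$ have unique solutions) and $a-b=(a+c)-(b+c)$ for all $a,b,c\in N$. -}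

module Defs where

open import Level using (Level)
open import Data.Product using (Σ; _×_; _,_)
open import Relation.Binary.PropositionalEquality using (_≡_)
open import Function.Bundles using (_↔_; Inverse)

∃!′ : {ℓ : Level} {A : Set ℓ} → (A → Set ℓ) → Set ℓ
∃!′ {A = A} P = Σ A λ x → P x × (∀ y → P y → x ≡ y)

IsQuasigroupOp : {ℓ : Level} {N : Set ℓ} → (N → N → N) → Set ℓ
IsQuasigroupOp {N = N} _∘_ =
  (a b : N) → ∃!′ (λ x → a ∘ x ≡ b) × ∃!′ (λ y → y ∘ a ≡ b)

record IsDFBQ {ℓ : Level} {N : Set ℓ} (_⊕_ _⊖_ : N → N → N) : Set ℓ where
  field
    ⊕-quasigroup : IsQuasigroupOp _⊕_
    ⊖-quasigroup : IsQuasigroupOp _⊖_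
    compat       : (a b c : N) → a ⊖ b ≡ (a ⊕ c) ⊖ (b ⊕ c)

module Transport {ℓ : Level} {N : Set ℓ} (_⊕_ _⊖_ : N → N → N) (φ α : N ↔ N) where
  φ⁻¹ : N → N
  φ⁻¹ = Inverse.from φ

  _+′_ : N → N → N
  a +′ b = Inverse.to φ (φ⁻¹ a ⊕ φ⁻¹ b)

  _-′_ : N → N → N
  a -′ b = Inverse.to α (φ⁻¹ a ⊖ φ⁻¹ b)

-- Conjugating by bijections preserves unique solvability of equations, and the DFBQ
-- law survives because both operations are conjugated by the same φ on their arguments.
-- For the last identity, ē solves φ⁻¹e ⊕ φ⁻¹ē = e, so the DFBQ law rewrites
-- φ⁻¹a ⊕ φ⁻¹ē as φ⁻¹a ⊖ φ⁻¹e, which is a ⊖ e = a by the φ-invariance of ⊖.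
module Submission where

open import Defs
open import Level using (Level)
open import Algebra.Core using (Op₂)
open import Data.Product using (_×_; _,_; proj₁; proj₂)
open import Relation.Binary.PropositionalEquality
open import Function.Bundles using (_↔_; Inverse; Injection)
open import Function.Properties.Inverse using (Inverse⇒Injection)
open Inverse using (to; from; strictlyInverseˡ; strictlyInverseʳ; inverseˡ; inverseʳ)

∃!′-reindex : {ℓ : Level} {A B : Set ℓ} (k : A ↔ B) {P : A → Set ℓ} {Q : B → Set ℓ} →
  (∀ a → P a → Q (to k a)) → (∀ b → Q b → P (from k b)) → ∃!′ P → ∃!′ Q
∃!′-reindex k P⇒Q Q⇒P (a , Pa , unique) =
  to k a , P⇒Q a Pa ,
  λ b Qb → trans (cong (to k) (unique (from k b) (Q⇒P b Qb))) (strictlyInverseˡ k b)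

module _ {ℓ : Level} {N : Set ℓ} where

  conjugate : (g h : N ↔ N) → Op₂ N → Op₂ N
  conjugate g h _∘_ a b = to h (from g a ∘ from g b)

  conjugate-isQuasigroup : (g h : N ↔ N) {_∘_ : Op₂ N} →
    IsQuasigroupOp _∘_ → IsQuasigroupOp (conjugate g h _∘_)
  conjugate-isQuasigroup g h {_∘_} quasigroup a b =
    ∃!′-reindex g
      (λ x eq → inverseˡ h (trans (cong (from g a ∘_) (strictlyInverseʳ g x)) eq))
      (λ x eq → sym (inverseʳ h (sym eq)))
      (proj₁ (quasigroup (from g a) (from h b))) ,
    ∃!′-reindex g
      (λ y eq → inverseˡ h (trans (cong (_∘ from g a) (strictlyInverseʳ g y)) eq))
      (λ y eq → sym (inverseʳ h (sym eq)))
      (proj₂ (quasigroup (from g a) (from h b)))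

  conjugate-isDFBQ : {_⊕_ _⊖_ : Op₂ N} (φ α : N ↔ N) →
    IsDFBQ _⊕_ _⊖_ → IsDFBQ (conjugate φ φ _⊕_) (conjugate φ α _⊖_)
  conjugate-isDFBQ {_⊕_} {_⊖_} φ α dfbq = record
    { ⊕-quasigroup = conjugate-isQuasigroup φ φ ⊕-quasigroup
    ; ⊖-quasigroup = conjugate-isQuasigroup φ α ⊖-quasigroup
    ; compat       = λ a b c → cong (to α) (begin
        from φ a ⊖ from φ b
          ≡⟨ compat (from φ a) (from φ b) (from φ c) ⟩
        (from φ a ⊕ from φ c) ⊖ (from φ b ⊕ from φ c)
          ≡⟨ sym (cong₂ _⊖_ (strictlyInverseʳ φ _) (strictlyInverseʳ φ _)) ⟩
        from φ (conjugate φ φ _⊕_ a c) ⊖ from φ (conjugate φ φ _⊕_ b c) ∎)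
    }
    where
    open IsDFBQ dfbq
    open ≡-Reasoning

  conjugate-identityʳ : (φ : N ↔ N) {_∘_ : Op₂ N} {e : N} →
    (∀ a → a ∘ e ≡ a) → ∀ a → conjugate φ φ _∘_ a (to φ e) ≡ a
  conjugate-identityʳ φ {_∘_} {e} identityʳ a = begin
    to φ (from φ a ∘ from φ (to φ e))  ≡⟨ cong (λ x → to φ (from φ a ∘ x)) (strictlyInverseʳ φ e) ⟩
    to φ (from φ a ∘ e)                ≡⟨ cong (to φ) (identityʳ (from φ a)) ⟩
    to φ (from φ a)                    ≡⟨ strictlyInverseˡ φ a ⟩
    a                                  ∎
    where open ≡-Reasoning

  from-preserves : (φ : N ↔ N) {_∘_ : Op₂ N} →
    (∀ a b → a ∘ b ≡ to φ a ∘ to φ b) → ∀ a b → from φ a ∘ from φ b ≡ a ∘ b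
  from-preserves φ {_∘_} invariant a b =
    trans (invariant (from φ a) (from φ b))
          (cong₂ _∘_ (strictlyInverseˡ φ a) (strictlyInverseˡ φ b))

  ⊕-as-⊖ : {_⊕_ _⊖_ : Op₂ N} {e : N} → IsDFBQ _⊕_ _⊖_ →
    (∀ a → a ⊖ e ≡ a) → ∀ {b c} → b ⊕ c ≡ e → ∀ a → a ⊕ c ≡ a ⊖ b
  ⊕-as-⊖ {_⊕_} {_⊖_} {e} dfbq ⊖-identityʳ {b} {c} bc≡e a = begin
    a ⊕ c               ≡⟨ sym (⊖-identityʳ (a ⊕ c)) ⟩
    (a ⊕ c) ⊖ e         ≡⟨ cong ((a ⊕ c) ⊖_) (sym bc≡e) ⟩
    (a ⊕ c) ⊖ (b ⊕ c)   ≡⟨ sym (IsDFBQ.compat dfbq a b c) ⟩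
    a ⊖ b               ∎
    where open ≡-Reasoning

mainTheorem7 : {ℓ : Level} {N : Set ℓ} (_⊕_ _⊖_ : N → N → N) (e : N) →
    IsDFBQ _⊕_ _⊖_ →
    ((a : N) → a ⊕ e ≡ a) →
    ((a : N) → a ⊖ a ≡ e) →
    ((a : N) → a ⊖ e ≡ a) →
    (φ : N ↔ N) →
    ((a b : N) → a ⊖ b ≡ Inverse.to φ a ⊖ Inverse.to φ b) →
    (α : N ↔ N) →
    Inverse.to α e ≡ e →
    IsDFBQ (Transport._+′_ _⊕_ _⊖_ φ α) (Transport._-′_ _⊕_ _⊖_ φ α)
    × ((a : N) → Transport._+′_ _⊕_ _⊖_ φ α a (Inverse.to φ e) ≡ a)
    × ((a : N) → Transport._-′_ _⊕_ _⊖_ φ α a a ≡ e)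
    × ((a : N) → Inverse.to α a ≡ Transport._-′_ _⊕_ _⊖_ φ α a e)
    × ((ē : N) → Transport._+′_ _⊕_ _⊖_ φ α e ē ≡ Inverse.to φ e →
    (a : N) → Inverse.to φ a ≡ Transport._+′_ _⊕_ _⊖_ φ α a ē)
mainTheorem7 {N = N} _⊕_ _⊖_ e dfbq ⊕-identityʳ ⊖-self ⊖-identityʳ φ ⊖-invariant α αe≡e =
  conjugate-isDFBQ φ α dfbq , conjugate-identityʳ φ {_⊕_} ⊕-identityʳ , -′-self , α≡-′e , φ≡+′ē
  where
  open ≡-Reasoning
  _+′_ _-′_ : Op₂ N
  _+′_ = conjugate φ φ _⊕_
  _-′_ = conjugate φ α _⊖_

  from-⊖-identityʳ : ∀ a → from φ a ⊖ from φ e ≡ a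
  from-⊖-identityʳ a = trans (from-preserves φ ⊖-invariant a e) (⊖-identityʳ a)

  -′-self : ∀ a → a -′ a ≡ e
  -′-self a = trans (cong (to α) (⊖-self (from φ a))) αe≡e

  α≡-′e : ∀ a → to α a ≡ a -′ e
  α≡-′e a = cong (to α) (sym (from-⊖-identityʳ a))

  φ≡+′ē : ∀ ē → e +′ ē ≡ to φ e → ∀ a → to φ a ≡ a +′ ē
  φ≡+′ē ē ē-solves a = cong (to φ) (sym (begin
    from φ a ⊕ from φ ē  ≡⟨ ⊕-as-⊖ dfbq ⊖-identityʳ e⊕ē≡e (from φ a) ⟩
    from φ a ⊖ from φ e  ≡⟨ from-⊖-identityʳ a ⟩
    a                    ∎))
    where
    e⊕ē≡e : from φ e ⊕ from φ ē ≡ e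
    e⊕ē≡e = Injection.injective (Inverse⇒Injection φ) ē-solves
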